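{- Let $\mathcal{T}=(S,S_0,R)$ be a state-transition system. Define $R^a=\{((s,i),(s',i+1)) \mid i\in\mathbb{N},\ (s,s')\in R\setminus R_{id}\}\subseteq (S\times\mathbb{N})\times(S\times\mathbb{N})$, where $R_{id}=\{(s,s)\mid s\in S\}$, and $S_{lf}=\{s\in S \mid \exists i\ \forall j>i\ \neg\exists s'\ ((s,0),(s',j))\in (R^a)^*\}$, where $(R^a)^*$ is the reflexive transitive closure of $R^a$. If $S_0\subseteq S_{lf}$, then $\mathcal{T}$ is locally-finite.
   Context: A state-transition system is a triple $(S,S_0,R)$ with $S$ a (possibly infinite) set of states, $S_0\subseteq S$ the initial states and $R\subseteq S\times S$ the transition relation. A state is reachable if it is reachable from a state of $S_0$ by finitely many $R$-steps. An execution from a state $s$ is a sequence $s=s_0,s_1,s_2,\dots$ with $(s_i,s_{i+1})\in R$ for all $i$. The system is locally-finite if every execution starting from any reachable state goes through only finitely many distinct states. -}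

module Defs where

open import Level using (Level)
open import Data.Nat using (ℕ; zero; suc; _<_)
open import Data.Product using (Σ; ∃; _×_; _,_)
open import Data.List using (List)
open import Data.List.Membership.Propositional using (_∈_)
open import Relation.Nullary using (¬_)
open import Relation.Binary.PropositionalEquality using (_≡_; _≢_)
open import Relation.Binary.Construct.Closure.ReflexiveTransitive using (Star)

record TransitionSystem (a : Level) : Set (Level.suc a) where
  field
    S  : Set a
    S₀ : S → Set a
    R  : S → S → Set a

module _ {a : Level} (T : TransitionSystem a) where
  open TransitionSystem T

  Reachable : S → Set a
  Reachable s = ∃ λ s₀ → S₀ s₀ × Star R s₀ s

  IsExecutionFrom : S → (ℕ → S) → Set a
  IsExecutionFrom s e = (e 0 ≡ s) × (∀ i → R (e i) (e (suc i)))

  FinitelyManyStates : (ℕ → S) → Set a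
  FinitelyManyStates e = ∃ λ (L : List S) → ∀ i → e i ∈ L

  LocallyFinite : Set a
  LocallyFinite = ∀ s → Reachable s → ∀ e → IsExecutionFrom s e → FinitelyManyStates e

  data Rᵃ : S × ℕ → S × ℕ → Set a where
    step : ∀ {s s' i} → R s s' → s ≢ s' → Rᵃ (s , i) (s' , suc i)

  Slf : S → Set a
  Slf s = ∃ λ (i : ℕ) → ∀ j → i < j → ¬ (∃ λ s' → Star Rᵃ (s , 0) (s' , j))

module Submission where

-- Fix an initial state s₀ ∈ S_lf and call c an Rᵃ-level of a
-- state x when ((s₀,0),(x,c)) ∈ (Rᵃ)*.  An R-step from a state of level c
-- reaches a state of level c (identity step) or c+1 (proper step), so every
-- state reachable from s₀ — in particular every state of an execution
-- starting at a reachable state — has a level, and levels only grow along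
-- executions.  Since s₀ ∈ S_lf, all levels are bounded by some i.
--
-- An execution either is constant (finite range), or contains a proper step
-- n ↦ n+1, after which its suffix starts at a strictly higher level.  Hence
-- by induction on the budget b, with i ≤ c + b, every execution starting at
-- level c visits finitely many states: its range is the prefix before the
-- step plus the (finite) range of the suffix.  Classical logic is used to
-- decide whether a step is proper and whether an execution is constant.

open import Defs
open import Level using (Level)
open import Axiom.ExcludedMiddle using (ExcludedMiddle)
open TransitionSystem using (S; S₀)

open import Data.Nat using (ℕ; zero; suc; s≤s; _+_; _∸_; _≤_; _<_; _<?_)
open import Data.Nat.Properties
  using (≤-refl; ≤-trans; ≤-reflexive; n≤1+n; ≮⇒≥; +-suc; +-identityʳ; +-monoˡ-≤; m≤n+m; m∸n+n≡m; <-≤-trans; <-irrefl)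
open import Data.Product using (∃; ∃₂; _×_; _,_)
open import Data.Sum using (_⊎_; inj₁; inj₂)
open import Data.List using (List; _∷_; []; _++_; applyUpTo)
open import Data.List.Relation.Unary.Any using (here)
open import Data.List.Membership.Propositional using (_∈_)
open import Data.List.Membership.Propositional.Properties using (∈-++⁺ˡ; ∈-++⁺ʳ; ∈-applyUpTo⁺)
open import Relation.Nullary using (yes; no)
open import Data.Empty using (⊥-elim)
open import Relation.Binary.PropositionalEquality using (_≡_; _≢_; refl; sym; trans; subst)
open import Relation.Binary.Construct.Closure.ReflexiveTransitive using (Star; ε; _◅_; _◅◅_)

module Sequences {a : Level} {A : Set a} where

  HasFiniteRange : (ℕ → A) → Set a
  HasFiniteRange e = ∃ λ (L : List A) → ∀ k → e k ∈ L

  constant-finite : (e : ℕ → A) → (∀ m → e m ≡ e 0) → HasFiniteRange e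
  constant-finite e constant = e 0 ∷ [] , λ k → here (constant k)

  -- finiteness of the range is decided by any suffix: the prefix e 0, …, e (n-1)
  -- contributes finitely many further values
  shift-finite : (e : ℕ → A) (n : ℕ) → HasFiniteRange (λ m → e (m + n)) → HasFiniteRange e
  shift-finite e n (L , in-L) = applyUpTo e n ++ L , in-prefix-or-suffix
    where
    in-prefix-or-suffix : ∀ k → e k ∈ applyUpTo e n ++ L
    in-prefix-or-suffix k with k <? n
    ... | yes k<n = ∈-++⁺ˡ (∈-applyUpTo⁺ e k<n)
    ... | no k≮n  = ∈-++⁺ʳ (applyUpTo e n)
                      (subst (λ j → e j ∈ L) (m∸n+n≡m (≮⇒≥ k≮n)) (in-L (k ∸ n)))

  constant-or-changes : ExcludedMiddle a → (e : ℕ → A)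
    → (∀ m → e m ≡ e 0) ⊎ ∃ λ n → e n ≢ e (suc n)
  constant-or-changes em e with em {∃ λ n → e n ≢ e (suc n)}
  ... | yes change  = inj₂ change
  ... | no nochange = inj₁ constant
    where
    constant : ∀ m → e m ≡ e 0
    constant zero = refl
    constant (suc m) with em {e m ≡ e (suc m)}
    ... | yes same = trans (sym same) (constant m)
    ... | no moved = ⊥-elim (nochange (m , moved))

open Sequences

execution-path : ∀ {a} {A : Set a} {R : A → A → Set a} (e : ℕ → A)
  → (∀ n → R (e n) (e (suc n))) → ∀ n → Star R (e 0) (e n)
execution-path e steps zero    = ε
execution-path e steps (suc n) = execution-path e steps n ◅◅ (steps n ◅ ε)

module Levels {a : Level} (em : ExcludedMiddle a) (T : TransitionSystem a) (origin : S T) where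
  open TransitionSystem T using (R)

  AtLevel : S T → ℕ → Set a
  AtLevel x c = Star (Rᵃ T) (origin , 0) (x , c)

  step-raises-level : ∀ {x y c} → R x y → AtLevel x c → ∃ λ c' → c ≤ c' × AtLevel y c'
  step-raises-level {x} {y} {c} r lev with em {x ≡ y}
  ... | yes refl = c , ≤-refl , lev
  ... | no x≢y   = suc c , n≤1+n c , lev ◅◅ (step r x≢y ◅ ε)

  path-raises-level : ∀ {x y c} → Star R x y → AtLevel x c → ∃ λ c' → c ≤ c' × AtLevel y c'
  path-raises-level ε lev = _ , ≤-refl , lev
  path-raises-level (r ◅ rs) lev with step-raises-level r lev
  ... | c₁ , c≤c₁ , lev₁ with path-raises-level rs lev₁
  ... | c₂ , c₁≤c₂ , lev₂ = c₂ , ≤-trans c≤c₁ c₁≤c₂ , lev₂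

  level-bound : Slf T origin → ∃ λ i → ∀ {x j} → AtLevel x j → j ≤ i
  level-bound (i , unreachable) = i , λ {x} {j} lev → ≮⇒≥ (λ i<j → unreachable j i<j (x , lev))

  constant-or-climbs : ∀ (e : ℕ → S T) {c} → (∀ n → R (e n) (e (suc n))) → AtLevel (e 0) c
    → (∀ m → e m ≡ e 0) ⊎ ∃₂ λ n c' → c < c' × AtLevel (e n) c'
  constant-or-climbs e steps lev with constant-or-changes em e
  ... | inj₁ constant = inj₁ constant
  ... | inj₂ (n , moved) with path-raises-level (execution-path e steps n) lev
  ... | c' , c≤c' , lev' = inj₂ (suc n , suc c' , s≤s c≤c' , lev' ◅◅ (step (steps n) moved ◅ ε))

  module _ (i : ℕ) (bounded : ∀ {x j} → AtLevel x j → j ≤ i) where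

    bounded-execution-finite : ∀ b c (e : ℕ → S T) → (∀ n → R (e n) (e (suc n)))
      → AtLevel (e 0) c → i ≤ c + b → HasFiniteRange e
    bounded-execution-finite b c e steps lev budget with constant-or-climbs e steps lev
    ... | inj₁ constant = constant-finite e constant
    bounded-execution-finite zero c e steps lev budget | inj₂ (n , c' , c<c' , lev') =
      ⊥-elim (<-irrefl refl (<-≤-trans c<c' c'≤c))
      where
      c'≤c : c' ≤ c
      c'≤c = ≤-trans (bounded lev') (≤-trans budget (≤-reflexive (+-identityʳ c)))
    bounded-execution-finite (suc b) c e steps lev budget | inj₂ (n , c' , c<c' , lev') =
      shift-finite e n
        (bounded-execution-finite b c' (λ m → e (m + n)) (λ m → steps (m + n)) lev' smaller-budget)
      where
      smaller-budget : i ≤ c' + b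
      smaller-budget = ≤-trans budget (≤-trans (≤-reflexive (+-suc c b)) (+-monoˡ-≤ b c<c'))

  -- every execution from a state reachable from an origin in S_lf has finite
  -- range: its start has some level c, and the budget b = i suffices
  reachable-execution-finite : Slf T origin → (e : ℕ → S T) → Star R origin (e 0)
    → (∀ n → R (e n) (e (suc n))) → HasFiniteRange e
  reachable-execution-finite origin-lf e path steps
    with level-bound origin-lf | path-raises-level path ε
  ... | i , bounded | c , _ , lev = bounded-execution-finite i bounded i c e steps lev (m≤n+m i c)

theorem14 : {a : Level} → ExcludedMiddle a → (T : TransitionSystem a)
    → (∀ s → S₀ T s → Slf T s) → LocallyFinite T
theorem14 em T initial-lf s (s₀ , initial , path) e (refl , steps) =
  Levels.reachable-execution-finite em T s₀ (initial-lf s₀ initial) e path steps
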